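{- If $E$ is a ceer, then $E^+\leq\,=^{ce}$. In fact, $E^+$ is computably bireducible with the restriction of $=^{ce}$ to the set $\{e\in\mathbb N: W_e\text{ is }E\text{ -invariant}\}$.
   Context: A ceer is an equivalence relation on $\mathbb N$ that is computably enumerable as a set of pairs. $\phi_e$ is the $e$-th partial computable function and $W_e$ its domain. $=^{ce}$ is the equivalence relation on $\mathbb N$ with $e=^{ce}e'$ iff $W_e=W_{e'}$. A set $W$ is $E$-invariant if it is a union of $E$-classes. The computable FS-jump is $E^+$ on $\mathbb N$ with $e\mathrel{E^+}e'$ iff $\{[\phi_e(n)]_E:\phi_e(n)\downarrow\}=\{[\phi_{e'}(n)]_E:\phi_{e'}(n)\downarrow\}$. For equivalence relations $E,F$ on subsets $X,Y\subseteq\mathbb N$, $E\leq F$ means there is a computable function $f$ defined on $X$ with values in $Y$ such that $x\mathrel{E}x'\iff f(x)\mathrel{F}f(x')$ for $x,x'\in X$; bireducible means reducible both ways. -}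

module Defs where

open import Data.Nat using (ℕ; zero; suc; _+_; _*_)
open import Data.Nat.Base using (_/_)
open import Data.Product using (Σ; ∃; _×_; _,_; proj₁; proj₂)
open import Data.Maybe using (Maybe; just; nothing; _>>=_)
open import Relation.Binary.PropositionalEquality using (_≡_)
open import Relation.Binary.Structures using (IsEquivalence)
open import Function.Bundles using (_⇔_)
open import Data.Unit using (⊤)

-- Cantor pairing ⟨a , b⟩ = T(a+b) + b, and its inverse defined by
-- enumerating ℕ×ℕ along anti-diagonals.

triangle : ℕ → ℕ
triangle n = (n * suc n) / 2

pair : ℕ → ℕ → ℕ
pair a b = triangle (a + b) + b

unpair : ℕ → ℕ × ℕ
unpair zero = 0 , 0
unpair (suc n) with unpair n
... | zero    , b = suc b , 0
... | suc a   , b = a , suc b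

-- A model of computation: unary partial recursive functions on ℕ
-- (using pairing), with primitive recursion and unbounded minimisation.

data Code : Set where
  Zc    : Code
  Sc    : Code
  Ic    : Code
  Fstc  : Code
  Sndc  : Code
  Compc : Code → Code → Code   -- Compc f g : x ↦ f (g x)
  Pairc : Code → Code → Code
  Recc  : Code → Code → Code   -- h⟨x,0⟩ = f x ; h⟨x,n+1⟩ = g⟨x,⟨n,h⟨x,n⟩⟩⟩
  Muc   : Code → Code          -- x ↦ least n with f⟨x,n⟩ = 0 (earlier values defined)

mutual
  eval : ℕ → Code → ℕ → Maybe ℕ
  eval zero    _           _ = nothing
  eval (suc k) Zc          x = just 0
  eval (suc k) Sc          x = just (suc x)
  eval (suc k) Ic          x = just x
  eval (suc k) Fstc        x = just (proj₁ (unpair x))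
  eval (suc k) Sndc        x = just (proj₂ (unpair x))
  eval (suc k) (Compc f g) x = eval k g x >>= eval k f
  eval (suc k) (Pairc f g) x =
    eval k f x >>= λ a → eval k g x >>= λ b → just (pair a b)
  eval (suc k) (Recc f g)  x = recAux k f g (proj₁ (unpair x)) (proj₂ (unpair x))
  eval (suc k) (Muc f)     x = muAux k f x 0 k

  recAux : ℕ → Code → Code → ℕ → ℕ → Maybe ℕ
  recAux k f g a zero    = eval k f a
  recAux k f g a (suc n) = recAux k f g a n >>= λ r → eval k g (pair a (pair n r))

  muAux : ℕ → Code → ℕ → ℕ → ℕ → Maybe ℕ
  muAux k f x i zero    = nothing
  muAux k f x i (suc j) = eval k f (pair x i) >>= λ
    { zero    → just i
    ; (suc _) → muAux k f x (suc i) j }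

-- Gödel numbering: n = ⟨tag , rest⟩ (a computable surjection ℕ → Code).
decodeF : ℕ → ℕ → Code
decodeF zero    _ = Zc
decodeF (suc k) n with unpair n
... | 0 , _ = Zc
... | 1 , _ = Sc
... | 2 , _ = Ic
... | 3 , _ = Fstc
... | 4 , _ = Sndc
... | 5 , r = Compc (decodeF k (proj₁ (unpair r))) (decodeF k (proj₂ (unpair r)))
... | 6 , r = Pairc (decodeF k (proj₁ (unpair r))) (decodeF k (proj₂ (unpair r)))
... | 7 , r = Recc  (decodeF k (proj₁ (unpair r))) (decodeF k (proj₂ (unpair r)))
... | 8 , r = Muc   (decodeF k r)
... | _ , _ = Zc

decode : ℕ → Code
decode n = decodeF (suc n) n

φ[_]_↓_ : ℕ → ℕ → ℕ → Set
φ[ e ] n ↓ m = ∃ λ k → eval k (decode e) n ≡ just m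

W : ℕ → ℕ → Set
W e n = ∃ λ m → φ[ e ] n ↓ m

Rel : Set₁
Rel = ℕ → ℕ → Set

Pred : Set₁
Pred = ℕ → Set

IsCeer : Rel → Set
IsCeer E = IsEquivalence E × ∃ λ i → ∀ x y → (E x y ⇔ W i (pair x y))

_=ce_ : Rel
e =ce e′ = ∀ n → (W e n ⇔ W e′ n)

Invariant : Rel → Pred
Invariant E e = ∀ x y → E x y → W e x → W e y

Jump : Rel → Rel
Jump E e e′ =
  (∀ n m → φ[ e ] n ↓ m → ∃ λ n′ → ∃ λ m′ → φ[ e′ ] n′ ↓ m′ × E m m′) ×
  (∀ n′ m′ → φ[ e′ ] n′ ↓ m′ → ∃ λ n → ∃ λ m → φ[ e ] n ↓ m × E m m′)

Reduces : Pred → Rel → Pred → Rel → Set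
Reduces X E Y F = ∃ λ f →
  (∀ x → X x → ∃ λ y → φ[ f ] x ↓ y × Y y) ×
  (∀ x x′ y y′ → X x → X x′ → φ[ f ] x ↓ y → φ[ f ] x′ ↓ y′ →
      (E x x′ ⇔ F y y′))


Everything : Pred
Everything _ = ⊤

module Submission where

open import Defs
open import Data.Nat using (ℕ; zero; suc; _+_; _*_; _⊔_; _≤_; _<_; _≤′_; ≤′-refl; ≤′-step; z≤n; s≤s; _/_; pred)
open import Data.Nat.Properties
open import Data.Nat.DivMod using (+-distrib-/-∣ʳ; m*n/n≡m)
open import Data.Nat.Divisibility using (divides)
open import Data.Nat.Tactic.RingSolver using (solve-∀)
open import Data.Maybe using (Maybe; just; _>>=_)
open import Data.Maybe.Properties using (just-injective)
open import Data.Product using (Σ; ∃; _×_; _,_; proj₁; proj₂)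
open import Data.List using (List; []; _∷_)
open import Data.Empty using (⊥; ⊥-elim)
open import Data.Unit using (tt)
open import Function.Base using (_∘_)
open import Function.Bundles using (_⇔_; mk⇔; Equivalence)
open import Function.Properties.Equivalence using () renaming (sym to ⇔-sym; trans to ⇔-trans)
open import Relation.Binary.PropositionalEquality
open import Relation.Binary.Structures using (IsEquivalence)

-- For an equivalence E, e E⁺ e′ says exactly that the E-saturations of the
-- ranges of φ_e and φ_e′ coincide (Jump⇔Image).  So a computable f with
-- W_{f(e)} = [ran φ_e]_E reduces E⁺ to =ce with E-invariant values, and a
-- computable g with ran φ_{g(e)} = W_e reduces =ce on E-invariant indices to
-- E⁺, since an invariant W_e is its own saturation (Image-of-invariant).
--
-- Both f and g need a universal function for the codes of Defs.

Range : ℕ → Pred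
Range e m = ∃ λ n → φ[ e ] n ↓ m

_≐_ : Pred → Pred → Set
A ≐ B = ∀ n → A n ⇔ B n

≐-sym : ∀ {A B} → A ≐ B → B ≐ A
≐-sym A≐B n = ⇔-sym (A≐B n)

≐-cong : ∀ {A A′ B B′} → A ≐ A′ → B ≐ B′ → (A ≐ B) ⇔ (A′ ≐ B′)
≐-cong A≐A′ B≐B′ = mk⇔
  (λ A≐B n → ⇔-trans (⇔-sym (A≐A′ n)) (⇔-trans (A≐B n) (B≐B′ n)))
  (λ A′≐B′ n → ⇔-trans (A≐A′ n) (⇔-trans (A′≐B′ n) (⇔-sym (B≐B′ n))))

-- The R-image of the range of φ_e; for an equivalence E, Image E e is the
-- E-saturation of the range.
Image : Rel → ℕ → Pred
Image R e n = ∃ λ m → Range e m × R m n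

Image-cong : ∀ {R R′} → (∀ m n → R m n ⇔ R′ m n) → ∀ e → Image R e ≐ Image R′ e
Image-cong R⇔R′ e n = mk⇔
  (λ { (m , range , r) → m , range , Equivalence.to (R⇔R′ m n) r })
  (λ { (m , range , r) → m , range , Equivalence.from (R⇔R′ m n) r })

module _ {E : Rel} (isEquivalence : IsEquivalence E) where
  open IsEquivalence isEquivalence renaming (refl to E-refl; sym to E-sym; trans to E-trans)

  Image-invariant : ∀ e {a b} → E a b → Image E e a → Image E e b
  Image-invariant e aEb (m , range , mEa) = m , range , E-trans mEa aEb

  Jump⇔Image : ∀ e e′ → Jump E e e′ ⇔ (Image E e ≐ Image E e′)
  Jump⇔Image e e′ = mk⇔ to from
    where
    to : Jump E e e′ → Image E e ≐ Image E e′
    to (forth , back) n = mk⇔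
      (λ { (m , (k , h) , mEn) → let (k′ , m′ , h′ , mEm′) = forth k m h in
                                 m′ , (k′ , h′) , E-trans (E-sym mEm′) mEn })
      (λ { (m′ , (k′ , h′) , m′En) → let (k , m , h , mEm′) = back k′ m′ h′ in
                                     m , (k , h) , E-trans mEm′ m′En })
    from : Image E e ≐ Image E e′ → Jump E e e′
    from same = forth , back
      where
      forth : ∀ n m → φ[ e ] n ↓ m → ∃ λ n′ → ∃ λ m′ → φ[ e′ ] n′ ↓ m′ × E m m′
      forth n m h with Equivalence.to (same m) (m , (n , h) , E-refl)
      ... | m′ , (n′ , h′) , m′Em = n′ , m′ , h′ , E-sym m′Em
      back : ∀ n′ m′ → φ[ e′ ] n′ ↓ m′ → ∃ λ n → ∃ λ m → φ[ e ] n ↓ m × E m m′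
      back n′ m′ h′ with Equivalence.from (same m′) (m′ , (n′ , h′) , E-refl)
      ... | m , (n , h) , mEm′ = n , m , h , mEm′

  Image-of-invariant : ∀ x g → Invariant E x → W x ≐ Range g → Image E g ≐ W x
  Image-of-invariant x g invariant W≐Range n = mk⇔
    (λ { (m , range , mEn) → invariant m n mEn (Equivalence.from (W≐Range m) range) })
    (λ n∈W → n , Equivalence.to (W≐Range n) n∈W , E-refl)

triangle-suc : ∀ n → triangle (suc n) ≡ triangle n + suc n
triangle-suc n = begin
  (suc n * suc (suc n)) / 2    ≡⟨ cong (_/ 2) (expand n) ⟩
  (n * suc n + suc n * 2) / 2  ≡⟨ +-distrib-/-∣ʳ (n * suc n) (divides (suc n) refl) ⟩
  triangle n + suc n * 2 / 2   ≡⟨ cong (triangle n +_) (m*n/n≡m (suc n) 2) ⟩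
  triangle n + suc n           ∎
  where
  open ≡-Reasoning
  expand : ∀ n → suc n * suc (suc n) ≡ n * suc n + suc n * 2
  expand = solve-∀

pair-zero-suc : ∀ b → suc (pair 0 b) ≡ pair (suc b) 0
pair-zero-suc b = begin
  suc (triangle b + b)              ≡⟨ cong suc (+-comm (triangle b) b) ⟩
  suc b + triangle b                ≡⟨ +-comm (suc b) (triangle b) ⟩
  triangle b + suc b                ≡⟨ sym (triangle-suc b) ⟩
  triangle (suc b)                  ≡⟨ cong triangle (sym (+-identityʳ (suc b))) ⟩
  triangle (suc b + 0)              ≡⟨ sym (+-identityʳ _) ⟩
  triangle (suc b + 0) + 0          ∎
  where open ≡-Reasoning

pair-suc-fst : ∀ a b → suc (pair (suc a) b) ≡ pair a (suc b)
pair-suc-fst a b = trans (sym (+-suc (triangle (suc a + b)) b))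
                         (cong (λ s → triangle s + suc b) (sym (+-suc a b)))

next : ℕ × ℕ → ℕ × ℕ
next (zero  , b) = suc b , 0
next (suc a , b) = a , suc b

unpair-suc : ∀ n → unpair (suc n) ≡ next (unpair n)
unpair-suc n with unpair n
... | zero  , b = refl
... | suc a , b = refl

-- unpair inverts pair; the induction runs along the anti-diagonal a + b = s.
unpair-pair : ∀ a b → unpair (pair a b) ≡ (a , b)
unpair-pair a b = along (a + b) a b refl
  where
  along : ∀ s a b → a + b ≡ s → unpair (pair a b) ≡ (a , b)
  along s a (suc b) a+b≡s
    rewrite sym (pair-suc-fst a b)
          | along s (suc a) b (trans (sym (+-suc a b)) a+b≡s) = refl
  along s       zero    zero a+b≡s = refl
  along (suc s) (suc a) zero a+b≡s
    rewrite sym (pair-zero-suc a)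
          | along s zero a (suc-injective (trans (cong suc (sym (+-identityʳ a))) a+b≡s)) = refl
  along zero    (suc a) zero ()

pair-unpair : ∀ n → pair (proj₁ (unpair n)) (proj₂ (unpair n)) ≡ n
pair-unpair zero = refl
pair-unpair (suc n) rewrite unpair-suc n = step (unpair n) (pair-unpair n)
  where
  step : ∀ p → pair (proj₁ p) (proj₂ p) ≡ n → pair (proj₁ (next p)) (proj₂ (next p)) ≡ suc n
  step (zero  , b) e = trans (sym (pair-zero-suc b)) (cong suc e)
  step (suc a , b) e = trans (sym (pair-suc-fst a b)) (cong suc e)

unpair-sum : ∀ n → proj₁ (unpair n) + proj₂ (unpair n) ≤ n
unpair-sum zero = z≤n
unpair-sum (suc n) rewrite unpair-suc n = step (unpair n) (unpair-sum n)
  where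
  step : ∀ p → proj₁ p + proj₂ p ≤ n → proj₁ (next p) + proj₂ (next p) ≤ suc n
  step (zero  , b) h = s≤s (≤-trans (≤-reflexive (+-identityʳ b)) h)
  step (suc a , b) h = ≤-trans (≤-reflexive (+-suc a b)) (m≤n⇒m≤1+n h)

fstN sndN : ℕ → ℕ
fstN n = proj₁ (unpair n)
sndN n = proj₂ (unpair n)

fstN≤ : ∀ n → fstN n ≤ n
fstN≤ n = ≤-trans (m≤m+n _ _) (unpair-sum n)

sndN≤ : ∀ n → sndN n ≤ n
sndN≤ n = ≤-trans (m≤n+m _ _) (unpair-sum n)

-- Below, pairing is used through an opaque copy pr, so that the type checker
-- never unfolds the arithmetic of triangle when normalising machine states.
opaque
  pr : ℕ → ℕ → ℕ
  pr = pair

  pr≡pair : ∀ a b → pr a b ≡ pair a b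
  pr≡pair a b = refl

  pr²≡pair² : ∀ a b c → pr a (pr b c) ≡ pair a (pair b c)
  pr²≡pair² a b c = refl

unpair-pr : ∀ a b → unpair (pr a b) ≡ (a , b)
unpair-pr a b = trans (cong unpair (pr≡pair a b)) (unpair-pair a b)

fst-pr : ∀ a b → fstN (pr a b) ≡ a
fst-pr a b = cong proj₁ (unpair-pr a b)

snd-pr : ∀ a b → sndN (pr a b) ≡ b
snd-pr a b = cong proj₂ (unpair-pr a b)

pr-unpair : ∀ n → pr (fstN n) (sndN n) ≡ n
pr-unpair n = trans (pr≡pair _ _) (pair-unpair n)

pr-injective : ∀ {a b c d} → pr a b ≡ pr c d → a ≡ c × b ≡ d
pr-injective {a} {b} {c} {d} e =
  trans (sym (fst-pr a b)) (trans (cong fstN e) (fst-pr c d)) ,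
  trans (sym (snd-pr a b)) (trans (cong sndN e) (snd-pr c d))

tail< : ∀ {m t r} → unpair m ≡ (suc t , r) → r < m
tail< {m} {t} {r} eq =
  ≤-trans (s≤s (m≤n+m r t)) (subst (λ p → proj₁ p + proj₂ p ≤ m) eq (unpair-sum m))

tail-fst< : ∀ {m t r} → unpair m ≡ (suc t , r) → fstN r < m
tail-fst< {r = r} eq = ≤-<-trans (fstN≤ r) (tail< eq)

tail-snd< : ∀ {m t r} → unpair m ≡ (suc t , r) → sndN r < m
tail-snd< {r = r} eq = ≤-<-trans (sndN≤ r) (tail< eq)

mutual
  decodeF-stable : ∀ k k′ m → m < k → m < k′ → decodeF k m ≡ decodeF k′ m
  decodeF-stable (suc k) (suc k′) m (s≤s m≤k) (s≤s m≤k′) with unpair m in eq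
  ... | 0 , _ = refl
  ... | 1 , _ = refl
  ... | 2 , _ = refl
  ... | 3 , _ = refl
  ... | 4 , _ = refl
  ... | 5 , r = cong₂ Compc (stable-below m≤k m≤k′ (tail-fst< eq)) (stable-below m≤k m≤k′ (tail-snd< eq))
  ... | 6 , r = cong₂ Pairc (stable-below m≤k m≤k′ (tail-fst< eq)) (stable-below m≤k m≤k′ (tail-snd< eq))
  ... | 7 , r = cong₂ Recc  (stable-below m≤k m≤k′ (tail-fst< eq)) (stable-below m≤k m≤k′ (tail-snd< eq))
  ... | 8 , r = cong Muc (stable-below m≤k m≤k′ (tail< eq))
  ... | suc (suc (suc (suc (suc (suc (suc (suc (suc _)))))))) , _ = refl

  stable-below : ∀ {k k′ m y} → m ≤ k → m ≤ k′ → y < m → decodeF k y ≡ decodeF k′ y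
  stable-below {k} {k′} {y = y} m≤k m≤k′ y<m =
    decodeF-stable k k′ y (<-≤-trans y<m m≤k) (<-≤-trans y<m m≤k′)

decodeLayer : ℕ × ℕ → Code
decodeLayer (0 , _) = Zc
decodeLayer (1 , _) = Sc
decodeLayer (2 , _) = Ic
decodeLayer (3 , _) = Fstc
decodeLayer (4 , _) = Sndc
decodeLayer (5 , r) = Compc (decode (fstN r)) (decode (sndN r))
decodeLayer (6 , r) = Pairc (decode (fstN r)) (decode (sndN r))
decodeLayer (7 , r) = Recc  (decode (fstN r)) (decode (sndN r))
decodeLayer (8 , r) = Muc (decode r)
decodeLayer (suc (suc (suc (suc (suc (suc (suc (suc (suc _)))))))) , _) = Zc

decodeF-decode : ∀ k {y} → y < k → decodeF k y ≡ decode y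
decodeF-decode k {y} y<k = decodeF-stable k (suc y) y y<k ≤-refl

decode-unfold : ∀ m → decode m ≡ decodeLayer (unpair m)
decode-unfold m with unpair m in eq
... | 0 , _ = refl
... | 1 , _ = refl
... | 2 , _ = refl
... | 3 , _ = refl
... | 4 , _ = refl
... | 5 , r = cong₂ Compc (decodeF-decode m (tail-fst< eq)) (decodeF-decode m (tail-snd< eq))
... | 6 , r = cong₂ Pairc (decodeF-decode m (tail-fst< eq)) (decodeF-decode m (tail-snd< eq))
... | 7 , r = cong₂ Recc  (decodeF-decode m (tail-fst< eq)) (decodeF-decode m (tail-snd< eq))
... | 8 , r = cong Muc (decodeF-decode m (tail< eq))
... | suc (suc (suc (suc (suc (suc (suc (suc (suc _)))))))) , _ = refl

encode : Code → ℕ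
encode Zc          = pr 0 0
encode Sc          = pr 1 0
encode Ic          = pr 2 0
encode Fstc        = pr 3 0
encode Sndc        = pr 4 0
encode (Compc f g) = pr 5 (pr (encode f) (encode g))
encode (Pairc f g) = pr 6 (pr (encode f) (encode g))
encode (Recc f g)  = pr 7 (pr (encode f) (encode g))
encode (Muc f)     = pr 8 (encode f)

decode-encode : ∀ c → decode (encode c) ≡ c
decode-encode Zc   = trans (decode-unfold (pr 0 0)) (cong decodeLayer (unpair-pr 0 0))
decode-encode Sc   = trans (decode-unfold (pr 1 0)) (cong decodeLayer (unpair-pr 1 0))
decode-encode Ic   = trans (decode-unfold (pr 2 0)) (cong decodeLayer (unpair-pr 2 0))
decode-encode Fstc = trans (decode-unfold (pr 3 0)) (cong decodeLayer (unpair-pr 3 0))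
decode-encode Sndc = trans (decode-unfold (pr 4 0)) (cong decodeLayer (unpair-pr 4 0))
decode-encode (Compc f g)
  rewrite decode-unfold (pr 5 (pr (encode f) (encode g))) | unpair-pr 5 (pr (encode f) (encode g))
        | unpair-pr (encode f) (encode g) = cong₂ Compc (decode-encode f) (decode-encode g)
decode-encode (Pairc f g)
  rewrite decode-unfold (pr 6 (pr (encode f) (encode g))) | unpair-pr 6 (pr (encode f) (encode g))
        | unpair-pr (encode f) (encode g) = cong₂ Pairc (decode-encode f) (decode-encode g)
decode-encode (Recc f g)
  rewrite decode-unfold (pr 7 (pr (encode f) (encode g))) | unpair-pr 7 (pr (encode f) (encode g))
        | unpair-pr (encode f) (encode g) = cong₂ Recc (decode-encode f) (decode-encode g)
decode-encode (Muc f)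
  rewrite decode-unfold (pr 8 (encode f)) | unpair-pr 8 (encode f) = cong Muc (decode-encode f)

bind-just : ∀ {m : Maybe ℕ} {f : ℕ → Maybe ℕ} {v} → (m >>= f) ≡ just v →
            Σ ℕ λ w → m ≡ just w × f w ≡ just v
bind-just {just w} e = w , refl , e

bind-eq : ∀ {m : Maybe ℕ} {f : ℕ → Maybe ℕ} {w v} → m ≡ just w → f w ≡ just v → (m >>= f) ≡ just v
bind-eq refl e = e

monotone-≤ : (f : ℕ → Maybe ℕ) → (∀ {k v} → f k ≡ just v → f (suc k) ≡ just v) →
             ∀ {k k′ v} → k ≤ k′ → f k ≡ just v → f k′ ≡ just v
monotone-≤ f step k≤k′ = along (≤⇒≤′ k≤k′)
  where
  along : ∀ {k k′ v} → k ≤′ k′ → f k ≡ just v → f k′ ≡ just v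
  along ≤′-refl       e = e
  along (≤′-step k≤k′) e = step (along k≤k′ e)

muAux-bound : ∀ k f x i j v → muAux k f x i j ≡ just v → muAux k f x i (suc j) ≡ just v
muAux-bound k f x i (suc j) v e with bind-just {eval k f (pair x i)} e
... | zero  , e₁ , e₂ rewrite e₁ = e₂
... | suc _ , e₁ , e₂ rewrite e₁ = muAux-bound k f x (suc i) j v e₂

mutual
  eval-suc : ∀ k c x v → eval k c x ≡ just v → eval (suc k) c x ≡ just v
  eval-suc (suc k) Zc   x v e = e
  eval-suc (suc k) Sc   x v e = e
  eval-suc (suc k) Ic   x v e = e
  eval-suc (suc k) Fstc x v e = e
  eval-suc (suc k) Sndc x v e = e
  eval-suc (suc k) (Compc f g) x v e with bind-just {eval k g x} e
  ... | w , e₁ , e₂ rewrite eval-suc k g x w e₁ = eval-suc k f w v e₂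
  eval-suc (suc k) (Pairc f g) x v e with bind-just {eval k f x} e
  ... | a , e₁ , e₂ with bind-just {eval k g x} e₂
  ... | b , e₃ , e₄ rewrite eval-suc k f x a e₁ | eval-suc k g x b e₃ = e₄
  eval-suc (suc k) (Recc f g) x v e = recAux-suc k f g (fstN x) (sndN x) v e
  eval-suc (suc k) (Muc f)    x v e = muAux-suc k f x 0 (suc k) v (muAux-bound k f x 0 k v e)

  recAux-suc : ∀ k f g a n v → recAux k f g a n ≡ just v → recAux (suc k) f g a n ≡ just v
  recAux-suc k f g a zero    v e = eval-suc k f a v e
  recAux-suc k f g a (suc n) v e with bind-just {recAux k f g a n} e
  ... | r , e₁ , e₂ rewrite recAux-suc k f g a n r e₁ = eval-suc k g _ v e₂

  muAux-suc : ∀ k f x i j v → muAux k f x i j ≡ just v → muAux (suc k) f x i j ≡ just v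
  muAux-suc k f x i (suc j) v e with bind-just {eval k f (pair x i)} e
  ... | zero  , e₁ , e₂ rewrite eval-suc k f (pair x i) 0 e₁ = e₂
  ... | suc w , e₁ , e₂ rewrite eval-suc k f (pair x i) (suc w) e₁ = muAux-suc k f x (suc i) j v e₂

eval-≤ : ∀ {k k′} c x {v} → k ≤ k′ → eval k c x ≡ just v → eval k′ c x ≡ just v
eval-≤ c x = monotone-≤ (λ k → eval k c x) (eval-suc _ c x _)

recAux-≤ : ∀ {k k′} f g a n {v} → k ≤ k′ → recAux k f g a n ≡ just v → recAux k′ f g a n ≡ just v
recAux-≤ f g a n = monotone-≤ (λ k → recAux k f g a n) (recAux-suc _ f g a n _)

muAux-≤ : ∀ {k k′ j j′} f x i {v} → k ≤ k′ → j ≤ j′ → muAux k f x i j ≡ just v → muAux k′ f x i j′ ≡ just v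
muAux-≤ {k} {k′} {j} f x i k≤k′ j≤j′ e =
  monotone-≤ (muAux k′ f x i) (muAux-bound k′ f x i _ _) j≤j′
    (monotone-≤ (λ k → muAux k f x i j) (muAux-suc _ f x i j _) k≤k′ e)

eval-deterministic : ∀ k k′ c x {v v′} → eval k c x ≡ just v → eval k′ c x ≡ just v′ → v ≡ v′
eval-deterministic k k′ c x e e′ =
  just-injective (trans (sym (eval-≤ c x (m≤m⊔n k k′) e)) (eval-≤ c x (m≤n⊔m k k′) e′))

-- Big-step semantics: c ⇓ x ↦ v says that the code c maps x to v.
-- It is equivalent to convergence of eval (eval⇒⇓, ⇓⇒eval) and is the
-- form in which all later reasoning about codes is done.
mutual
  data _⇓_↦_ : Code → ℕ → ℕ → Set where
    ⇓Z : ∀ {x} → Zc ⇓ x ↦ 0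
    ⇓S : ∀ {x} → Sc ⇓ x ↦ suc x
    ⇓I : ∀ {x} → Ic ⇓ x ↦ x
    ⇓F : ∀ {x} → Fstc ⇓ x ↦ fstN x
    ⇓N : ∀ {x} → Sndc ⇓ x ↦ sndN x
    ⇓C : ∀ {f g x w v} → g ⇓ x ↦ w → f ⇓ w ↦ v → Compc f g ⇓ x ↦ v
    ⇓P : ∀ {f g x a b} → f ⇓ x ↦ a → g ⇓ x ↦ b → Pairc f g ⇓ x ↦ pr a b
    ⇓R : ∀ {f g x v} → RecR f g (fstN x) (sndN x) v → Recc f g ⇓ x ↦ v
    ⇓M : ∀ {f x v} → MuR f x 0 v → Muc f ⇓ x ↦ v

  data RecR (f g : Code) (a : ℕ) : ℕ → ℕ → Set where
    rz : ∀ {r} → f ⇓ a ↦ r → RecR f g a 0 r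
    rs : ∀ {n r r′} → RecR f g a n r → g ⇓ pr a (pr n r) ↦ r′ → RecR f g a (suc n) r′

  data MuR (f : Code) (x : ℕ) : ℕ → ℕ → Set where
    mz : ∀ {i} → f ⇓ pr x i ↦ 0 → MuR f x i i
    ms : ∀ {i w v} → f ⇓ pr x i ↦ suc w → MuR f x (suc i) v → MuR f x i v

mutual
  eval⇒⇓ : ∀ k c x v → eval k c x ≡ just v → c ⇓ x ↦ v
  eval⇒⇓ (suc k) Zc   x v refl = ⇓Z
  eval⇒⇓ (suc k) Sc   x v refl = ⇓S
  eval⇒⇓ (suc k) Ic   x v refl = ⇓I
  eval⇒⇓ (suc k) Fstc x v refl = ⇓F
  eval⇒⇓ (suc k) Sndc x v refl = ⇓N
  eval⇒⇓ (suc k) (Compc f g) x v e with bind-just {eval k g x} e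
  ... | w , e₁ , e₂ = ⇓C (eval⇒⇓ k g x w e₁) (eval⇒⇓ k f w v e₂)
  eval⇒⇓ (suc k) (Pairc f g) x v e with bind-just {eval k f x} e
  ... | a , e₁ , e₂ with bind-just {eval k g x} e₂
  ... | b , e₃ , refl =
    subst (Pairc f g ⇓ x ↦_) (pr≡pair a b) (⇓P (eval⇒⇓ k f x a e₁) (eval⇒⇓ k g x b e₃))
  eval⇒⇓ (suc k) (Recc f g) x v e = ⇓R (recAux⇒RecR k f g _ _ v e)
  eval⇒⇓ (suc k) (Muc f)    x v e = ⇓M (muAux⇒MuR k f x 0 k v e)

  recAux⇒RecR : ∀ k f g a n v → recAux k f g a n ≡ just v → RecR f g a n v
  recAux⇒RecR k f g a zero    v e = rz (eval⇒⇓ k f a v e)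
  recAux⇒RecR k f g a (suc n) v e with bind-just {recAux k f g a n} e
  ... | r , e₁ , e₂ =
    rs (recAux⇒RecR k f g a n r e₁) (subst (g ⇓_↦ v) (sym (pr²≡pair² a n r)) (eval⇒⇓ k g _ v e₂))

  muAux⇒MuR : ∀ k f x i j v → muAux k f x i j ≡ just v → MuR f x i v
  muAux⇒MuR k f x i (suc j) v e with bind-just {eval k f (pair x i)} e
  ... | zero , e₁ , refl = mz (subst (f ⇓_↦ 0) (sym (pr≡pair x i)) (eval⇒⇓ k f _ 0 e₁))
  ... | suc w , e₁ , e₂ =
    ms (subst (f ⇓_↦ suc w) (sym (pr≡pair x i)) (eval⇒⇓ k f _ (suc w) e₁)) (muAux⇒MuR k f x (suc i) j v e₂)

mutual
  ⇓⇒eval : ∀ {c x v} → c ⇓ x ↦ v → ∃ λ k → eval k c x ≡ just v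
  ⇓⇒eval ⇓Z = 1 , refl
  ⇓⇒eval ⇓S = 1 , refl
  ⇓⇒eval ⇓I = 1 , refl
  ⇓⇒eval ⇓F = 1 , refl
  ⇓⇒eval ⇓N = 1 , refl
  ⇓⇒eval {Compc f g} {x} (⇓C {w = w} d₁ d₂) with ⇓⇒eval d₁ | ⇓⇒eval d₂
  ... | k₁ , e₁ | k₂ , e₂ = suc (k₁ ⊔ k₂) ,
    bind-eq {eval (k₁ ⊔ k₂) g x} (eval-≤ g x (m≤m⊔n k₁ k₂) e₁) (eval-≤ f w (m≤n⊔m k₁ k₂) e₂)
  ⇓⇒eval {Pairc f g} {x} (⇓P {a = a} {b = b} d₁ d₂) with ⇓⇒eval d₁ | ⇓⇒eval d₂
  ... | k₁ , e₁ | k₂ , e₂ = suc (k₁ ⊔ k₂) ,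
    bind-eq {eval (k₁ ⊔ k₂) f x} (eval-≤ f x (m≤m⊔n k₁ k₂) e₁)
      (bind-eq {eval (k₁ ⊔ k₂) g x} (eval-≤ g x (m≤n⊔m k₁ k₂) e₂) (cong just (sym (pr≡pair a b))))
  ⇓⇒eval (⇓R d) with RecR⇒recAux d
  ... | k , e = suc k , e
  ⇓⇒eval {Muc f} {x} (⇓M d) with MuR⇒muAux d
  ... | k , j , e = suc (k ⊔ j) , muAux-≤ f x 0 (m≤m⊔n k j) (m≤n⊔m k j) e

  RecR⇒recAux : ∀ {f g a n v} → RecR f g a n v → ∃ λ k → recAux k f g a n ≡ just v
  RecR⇒recAux (rz d) = ⇓⇒eval d
  RecR⇒recAux {f} {g} {a} (rs {n} {r} d₁ d₂) with RecR⇒recAux d₁ | ⇓⇒eval d₂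
  ... | k₁ , e₁ | k₂ , e₂ = k₁ ⊔ k₂ ,
    bind-eq {recAux (k₁ ⊔ k₂) f g a n} (recAux-≤ f g a n (m≤m⊔n k₁ k₂) e₁)
      (eval-≤ g _ (m≤n⊔m k₁ k₂) (subst (λ z → eval k₂ g z ≡ just _) (pr²≡pair² a n r) e₂))

  MuR⇒muAux : ∀ {f x i v} → MuR f x i v → ∃ λ k → ∃ λ j → muAux k f x i j ≡ just v
  MuR⇒muAux {f} {x} {i} (mz d) with ⇓⇒eval d
  ... | k , e = k , 1 , bind-eq {eval k f (pair x i)} (subst (λ z → eval k f z ≡ just 0) (pr≡pair x i) e) refl
  MuR⇒muAux {f} {x} {i} (ms {w = w} d₁ d₂) with ⇓⇒eval d₁ | MuR⇒muAux d₂
  ... | k₁ , e₁ | k₂ , j , e₂ = k₁ ⊔ k₂ , suc j ,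
    bind-eq {eval (k₁ ⊔ k₂) f (pair x i)}
      (eval-≤ f _ (m≤m⊔n k₁ k₂) (subst (λ z → eval k₁ f z ≡ just (suc w)) (pr≡pair x i) e₁))
      (muAux-≤ {j = j} f x (suc i) (m≤n⊔m k₁ k₂) ≤-refl e₂)

⇓-deterministic : ∀ {c x v v′} → c ⇓ x ↦ v → c ⇓ x ↦ v′ → v ≡ v′
⇓-deterministic d d′ with ⇓⇒eval d | ⇓⇒eval d′
... | k , e | k′ , e′ = eval-deterministic k k′ _ _ e e′

φ⇒⇓ : ∀ {e n m} → φ[ e ] n ↓ m → decode e ⇓ n ↦ m
φ⇒⇓ (k , h) = eval⇒⇓ k _ _ _ h

⇓⇒φ : ∀ {e n m} → decode e ⇓ n ↦ m → φ[ e ] n ↓ m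
⇓⇒φ = ⇓⇒eval

-- A language of total (primitive recursive) programs with a direct
-- semantics ⟦_⟧; each program compiles to a code computing its semantics.
infixr 9 _∘P_
data PR : Set where
  zP sP iP fstP sndP predP : PR
  _∘P_ ⟨_,_⟩P              : PR → PR → PR
  ifzP                     : PR → PR → PR → PR
  iterP                    : PR → PR
  kP                       : ℕ → PR

ifz : ℕ → ℕ → ℕ → ℕ
ifz zero    a b = a
ifz (suc _) a b = b

iterate : (ℕ → ℕ) → ℕ → ℕ → ℕ
iterate f zero    x = x
iterate f (suc n) x = f (iterate f n x)

⟦_⟧ : PR → ℕ → ℕ
⟦ zP ⟧         x = 0
⟦ sP ⟧         x = suc x
⟦ iP ⟧         x = x
⟦ fstP ⟧       x = fstN x
⟦ sndP ⟧       x = sndN x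
⟦ predP ⟧      x = pred x
⟦ p ∘P q ⟧     x = ⟦ p ⟧ (⟦ q ⟧ x)
⟦ ⟨ p , q ⟩P ⟧ x = pr (⟦ p ⟧ x) (⟦ q ⟧ x)
⟦ ifzP c a b ⟧ x = ifz (⟦ c ⟧ x) (⟦ a ⟧ x) (⟦ b ⟧ x)
⟦ iterP f ⟧    x = iterate ⟦ f ⟧ (sndN x) (fstN x)
⟦ kP n ⟧       x = n

constCode : ℕ → Code
constCode zero    = Zc
constCode (suc n) = Compc Sc (constCode n)

-- ifz and iteration are primitive recursions on the second component.
toCode : PR → Code
toCode zP           = Zc
toCode sP           = Sc
toCode iP           = Ic
toCode fstP         = Fstc
toCode sndP         = Sndc
toCode predP        = Compc (Recc Zc (Compc Fstc Sndc)) (Pairc Zc Ic)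
toCode (p ∘P q)     = Compc (toCode p) (toCode q)
toCode ⟨ p , q ⟩P   = Pairc (toCode p) (toCode q)
toCode (ifzP c a b) = Compc (Recc (toCode a) (Compc (toCode b) Fstc)) (Pairc Ic (toCode c))
toCode (iterP f)    = Recc Ic (Compc (toCode f) (Compc Sndc Sndc))
toCode (kP n)       = constCode n

⇓F-pr : ∀ a b → Fstc ⇓ pr a b ↦ a
⇓F-pr a b = subst (Fstc ⇓ pr a b ↦_) (fst-pr a b) ⇓F

⇓N-pr : ∀ a b → Sndc ⇓ pr a b ↦ b
⇓N-pr a b = subst (Sndc ⇓ pr a b ↦_) (snd-pr a b) ⇓N

⇓R-pr : ∀ {f g a n v} → RecR f g a n v → Recc f g ⇓ pr a n ↦ v
⇓R-pr {f} {g} {a} {n} {v} r = ⇓R (subst₂ (λ a′ n′ → RecR f g a′ n′ v) (sym (fst-pr a n)) (sym (snd-pr a n)) r)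

constCode-correct : ∀ n x → constCode n ⇓ x ↦ n
constCode-correct zero    x = ⇓Z
constCode-correct (suc n) x = ⇓C (constCode-correct n x) ⇓S

compile : ∀ p x → toCode p ⇓ x ↦ ⟦ p ⟧ x
compile zP   x = ⇓Z
compile sP   x = ⇓S
compile iP   x = ⇓I
compile fstP x = ⇓F
compile sndP x = ⇓N
compile predP x = ⇓C (⇓P ⇓Z ⇓I) (⇓R-pr (predecessor x))
  where
  predecessor : ∀ m → RecR Zc (Compc Fstc Sndc) 0 m (pred m)
  predecessor zero    = rz ⇓Z
  predecessor (suc m) = rs (predecessor m) (⇓C (⇓N-pr 0 (pr m (pred m))) (⇓F-pr m (pred m)))
compile (p ∘P q)   x = ⇓C (compile q x) (compile p (⟦ q ⟧ x))
compile ⟨ p , q ⟩P x = ⇓P (compile p x) (compile q x)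
compile (ifzP c a b) x = ⇓C (⇓P ⇓I (compile c x)) (⇓R-pr (branch (⟦ c ⟧ x)))
  where
  branch : ∀ m → RecR (toCode a) (Compc (toCode b) Fstc) x m (ifz m (⟦ a ⟧ x) (⟦ b ⟧ x))
  branch zero    = rz (compile a x)
  branch (suc m) = rs (branch m) (⇓C (⇓F-pr x _) (compile b x))
compile (iterP f) x = ⇓R (iteration (sndN x))
  where
  iteration : ∀ m → RecR Ic (Compc (toCode f) (Compc Sndc Sndc)) (fstN x) m (iterate ⟦ f ⟧ m (fstN x))
  iteration zero    = rz ⇓I
  iteration (suc m) = rs (iteration m) (⇓C (⇓C (⇓N-pr (fstN x) _) (⇓N-pr m _)) (compile f _))
compile (kP n) x = constCode-correct n x

compile-deterministic : ∀ p {x v} → toCode p ⇓ x ↦ v → v ≡ ⟦ p ⟧ x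
compile-deterministic p {x} d = ⇓-deterministic d (compile p x)

-- States of the abstract machine: EV c x K evaluates the code numbered c
-- on x under the continuation K; RT v K returns the value v to K.
EV : ℕ → ℕ → ℕ → ℕ
EV c x K = pr 0 (pr c (pr x K))

RT : ℕ → ℕ → ℕ
RT v K = pr 1 (pr v K)

-- Continuations: DONE is the empty one (unpair 0 = (0 , 0)); each frame
-- records what to do with the value returned to it.
DONE : ℕ
DONE = 0

CK : ℕ → ℕ → ℕ                 -- apply the code f to the value
CK f K = pr 1 (pr f K)

P1K : ℕ → ℕ → ℕ → ℕ            -- value is a; now evaluate g on x
P1K g x K = pr 2 (pr g (pr x K))

P2K : ℕ → ℕ → ℕ                -- value is b; return ⟨a , b⟩
P2K a K = pr 3 (pr a K)

RK : ℕ → ℕ → ℕ → ℕ → ℕ → ℕ     -- recursion g on a at stage i, rem stages left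
RK g a i rem K = pr 4 (pr g (pr a (pr i (pr rem K))))

MK : ℕ → ℕ → ℕ → ℕ → ℕ         -- minimisation of f on x, currently testing i
MK f x i K = pr 5 (pr f (pr x (pr i K)))

caseP : PR → List PR → PR → PR
caseP sel []       d = d
caseP sel (b ∷ bs) d = ifzP sel b (caseP (predP ∘P sel) bs d)

EVp : PR → PR → PR → PR
EVp c x K = ⟨ kP 0 , ⟨ c , ⟨ x , K ⟩P ⟩P ⟩P

RTp : PR → PR → PR
RTp v K = ⟨ kP 1 , ⟨ v , K ⟩P ⟩P

CKp : PR → PR → PR
CKp f K = ⟨ kP 1 , ⟨ f , K ⟩P ⟩P

P1Kp : PR → PR → PR → PR
P1Kp g x K = ⟨ kP 2 , ⟨ g , ⟨ x , K ⟩P ⟩P ⟩P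

P2Kp : PR → PR → PR
P2Kp a K = ⟨ kP 3 , ⟨ a , K ⟩P ⟩P

RKp : PR → PR → PR → PR → PR → PR
RKp g a i rem K = ⟨ kP 4 , ⟨ g , ⟨ a , ⟨ i , ⟨ rem , K ⟩P ⟩P ⟩P ⟩P ⟩P

MKp : PR → PR → PR → PR → PR
MKp f x i K = ⟨ kP 5 , ⟨ f , ⟨ x , ⟨ i , K ⟩P ⟩P ⟩P ⟩P

module Transition where
  F N : PR
  F = fstP
  N = sndP

  ec ex eK et er : PR
  ec = F ∘P N
  ex = F ∘P N ∘P N
  eK = N ∘P N ∘P N
  et = F ∘P ec
  er = N ∘P ec

  -- Dispatch on the instruction tag; unknown tags behave like Zc.
  evalStepP : PR
  evalStepP = caseP et
    ( RTp zP eK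
    ∷ RTp (sP ∘P ex) eK
    ∷ RTp ex eK
    ∷ RTp (F ∘P ex) eK
    ∷ RTp (N ∘P ex) eK
    ∷ EVp (N ∘P er) ex (CKp (F ∘P er) eK)
    ∷ EVp (F ∘P er) ex (P1Kp (N ∘P er) ex eK)
    ∷ EVp (F ∘P er) (F ∘P ex) (RKp (N ∘P er) (F ∘P ex) zP (N ∘P ex) eK)
    ∷ EVp er ⟨ ex , zP ⟩P (MKp er ex zP eK)
    ∷ [])
    (RTp zP eK)

  rv rK rt rr : PR
  rv = F ∘P N
  rK = N ∘P N
  rt = F ∘P rK
  rr = N ∘P rK

  -- Dispatch on the top frame; a returned value with the empty
  -- continuation is a fixed point.
  returnStepP : PR
  returnStepP = caseP rt
    ( iP
    ∷ EVp (F ∘P rr) rv (N ∘P rr)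
    ∷ EVp (F ∘P rr) (F ∘P N ∘P rr) (P2Kp rv (N ∘P N ∘P rr))
    ∷ RTp ⟨ F ∘P rr , rv ⟩P (N ∘P rr)
    ∷ ifzP (F ∘P N ∘P N ∘P N ∘P rr)
        (RTp rv (N ∘P N ∘P N ∘P N ∘P rr))
        (EVp (F ∘P rr) ⟨ F ∘P N ∘P rr , ⟨ F ∘P N ∘P N ∘P rr , rv ⟩P ⟩P
             (RKp (F ∘P rr) (F ∘P N ∘P rr) (sP ∘P F ∘P N ∘P N ∘P rr)
                  (predP ∘P F ∘P N ∘P N ∘P N ∘P rr) (N ∘P N ∘P N ∘P N ∘P rr)))
    ∷ ifzP rv
        (RTp (F ∘P N ∘P N ∘P rr) (N ∘P N ∘P N ∘P rr))
        (EVp (F ∘P rr) ⟨ F ∘P N ∘P rr , sP ∘P F ∘P N ∘P N ∘P rr ⟩P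
             (MKp (F ∘P rr) (F ∘P N ∘P rr) (sP ∘P F ∘P N ∘P N ∘P rr) (N ∘P N ∘P N ∘P rr)))
    ∷ [])
    iP

  stepP : PR
  stepP = ifzP F evalStepP returnStepP

open Transition using (stepP)

-- The transition function, kept opaque: its equations are the lemmas below.
opaque
  step : ℕ → ℕ
  step = ⟦ stepP ⟧

evalStep : ℕ → ℕ → ℕ → ℕ → ℕ
evalStep 0 r x K = RT 0 K
evalStep 1 r x K = RT (suc x) K
evalStep 2 r x K = RT x K
evalStep 3 r x K = RT (fstN x) K
evalStep 4 r x K = RT (sndN x) K
evalStep 5 r x K = EV (sndN r) x (CK (fstN r) K)
evalStep 6 r x K = EV (fstN r) x (P1K (sndN r) x K)
evalStep 7 r x K = EV (fstN r) (fstN x) (RK (sndN r) (fstN x) 0 (sndN x) K)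
evalStep 8 r x K = EV r (pr x 0) (MK r x 0 K)
evalStep (suc (suc (suc (suc (suc (suc (suc (suc (suc _))))))))) r x K = RT 0 K

opaque
  unfolding step
  step-EV-fields : ∀ s y z c x K → unpair s ≡ (0 , y) → unpair y ≡ (c , z) → unpair z ≡ (x , K) →
                   step s ≡ evalStep (fstN c) (sndN c) x K
  step-EV-fields s y z c x K e₁ e₂ e₃ rewrite e₁ | e₂ | e₃ with fstN c
  ... | 0 = refl
  ... | 1 = refl
  ... | 2 = refl
  ... | 3 = refl
  ... | 4 = refl
  ... | 5 = refl
  ... | 6 = refl
  ... | 7 = refl
  ... | 8 = refl
  ... | suc (suc (suc (suc (suc (suc (suc (suc (suc _)))))))) = refl

step-EV : ∀ c x K {t r} → unpair c ≡ (t , r) → step (EV c x K) ≡ evalStep t r x K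
step-EV c x K eq =
  trans (step-EV-fields (EV c x K) (pr c (pr x K)) (pr x K) c x K
           (unpair-pr 0 (pr c (pr x K))) (unpair-pr c (pr x K)) (unpair-pr x K))
        (cong (λ p → evalStep (proj₁ p) (proj₂ p) x K) eq)

returnStep : ℕ → ℕ → ℕ → ℕ → ℕ
returnStep s v 0 fr = s
returnStep s v 1 fr = EV (fstN fr) v (sndN fr)
returnStep s v 2 fr = EV (fstN fr) (fstN (sndN fr)) (P2K v (sndN (sndN fr)))
returnStep s v 3 fr = RT (pr (fstN fr) v) (sndN fr)
returnStep s v 4 fr = ifz (fstN (sndN (sndN (sndN fr)))) (RT v (sndN (sndN (sndN (sndN fr)))))
  (EV (fstN fr) (pr (fstN (sndN fr)) (pr (fstN (sndN (sndN fr))) v))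
      (RK (fstN fr) (fstN (sndN fr)) (suc (fstN (sndN (sndN fr))))
          (pred (fstN (sndN (sndN (sndN fr))))) (sndN (sndN (sndN (sndN fr))))))
returnStep s v 5 fr = ifz v (RT (fstN (sndN (sndN fr))) (sndN (sndN (sndN fr))))
  (EV (fstN fr) (pr (fstN (sndN fr)) (suc (fstN (sndN (sndN fr)))))
      (MK (fstN fr) (fstN (sndN fr)) (suc (fstN (sndN (sndN fr)))) (sndN (sndN (sndN fr)))))
returnStep s v (suc (suc (suc (suc (suc (suc _)))))) fr = s

opaque
  unfolding step
  step-RT-fields : ∀ s y v K t fr → unpair s ≡ (1 , y) → unpair y ≡ (v , K) → unpair K ≡ (t , fr) →
                   step s ≡ returnStep s v t fr
  step-RT-fields s y v K t fr e₁ e₂ e₃ rewrite e₁ | e₂ | e₃ with t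
  ... | 0 = refl
  ... | 1 = refl
  ... | 2 = refl
  ... | 3 = refl
  ... | 4 = refl
  ... | 5 = refl
  ... | suc (suc (suc (suc (suc (suc _))))) = refl

step-RT : ∀ v t fr → step (RT v (pr t fr)) ≡ returnStep (RT v (pr t fr)) v t fr
step-RT v t fr = step-RT-fields (RT v (pr t fr)) (pr v (pr t fr)) v (pr t fr) t fr
  (unpair-pr 1 (pr v (pr t fr))) (unpair-pr v (pr t fr)) (unpair-pr t fr)

step-DONE : ∀ v → step (RT v DONE) ≡ RT v DONE
step-DONE v = step-RT-fields (RT v 0) (pr v 0) v 0 0 0 (unpair-pr 1 (pr v 0)) (unpair-pr v 0) refl

step-CK : ∀ v f K → step (RT v (CK f K)) ≡ EV f v K
step-CK v f K rewrite step-RT v 1 (pr f K) | unpair-pr f K = refl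

step-P1K : ∀ v g x K → step (RT v (P1K g x K)) ≡ EV g x (P2K v K)
step-P1K v g x K rewrite step-RT v 2 (pr g (pr x K)) | unpair-pr g (pr x K) | unpair-pr x K = refl

step-P2K : ∀ v a K → step (RT v (P2K a K)) ≡ RT (pr a v) K
step-P2K v a K rewrite step-RT v 3 (pr a K) | unpair-pr a K = refl

step-RK : ∀ v g a i rem K →
          step (RT v (RK g a i rem K)) ≡ ifz rem (RT v K) (EV g (pr a (pr i v)) (RK g a (suc i) (pred rem) K))
step-RK v g a i rem K rewrite step-RT v 4 (pr g (pr a (pr i (pr rem K))))
  | unpair-pr g (pr a (pr i (pr rem K))) | unpair-pr a (pr i (pr rem K)) | unpair-pr i (pr rem K)
  | unpair-pr rem K = refl

step-MK : ∀ v f x i K → step (RT v (MK f x i K)) ≡ ifz v (RT i K) (EV f (pr x (suc i)) (MK f x (suc i) K))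
step-MK v f x i K rewrite step-RT v 5 (pr f (pr x (pr i K)))
  | unpair-pr f (pr x (pr i K)) | unpair-pr x (pr i K) | unpair-pr i K = refl

iterate-+ : ∀ (f : ℕ → ℕ) m n x → iterate f (m + n) x ≡ iterate f m (iterate f n x)
iterate-+ f zero    n x = refl
iterate-+ f (suc m) n x = cong f (iterate-+ f m n x)

iterate-suc : ∀ (f : ℕ → ℕ) n x → iterate f (suc n) x ≡ iterate f n (f x)
iterate-suc f zero    x = refl
iterate-suc f (suc n) x = cong f (iterate-suc f n x)

_↠_ : ℕ → ℕ → Set
s ↠ s′ = ∃ λ n → iterate step n s ≡ s′

↠-trans : ∀ {s₁ s₂ s₃} → s₁ ↠ s₂ → s₂ ↠ s₃ → s₁ ↠ s₃
↠-trans {s₁} (n₁ , e₁) (n₂ , e₂) =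
  n₂ + n₁ , trans (iterate-+ step n₂ n₁ s₁) (trans (cong (iterate step n₂) e₁) e₂)

↠-step : ∀ {s s′} → step s ≡ s′ → s ↠ s′
↠-step e = 1 , e

mutual
  machine-complete : ∀ {D x v} → D ⇓ x ↦ v → ∀ c → decode c ≡ D → ∀ K → EV c x K ↠ RT v K
  machine-complete d c e K = complete-by-layer c (unpair c) refl (trans (sym (decode-unfold c)) e) d K

  complete-by-layer : ∀ c p → unpair c ≡ p → ∀ {D x v} → decodeLayer p ≡ D → D ⇓ x ↦ v → ∀ K → EV c x K ↠ RT v K
  complete-by-layer c (0 , r) eq refl ⇓Z K = ↠-step (step-EV c _ K eq)
  complete-by-layer c (1 , r) eq refl ⇓S K = ↠-step (step-EV c _ K eq)
  complete-by-layer c (2 , r) eq refl ⇓I K = ↠-step (step-EV c _ K eq)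
  complete-by-layer c (3 , r) eq refl ⇓F K = ↠-step (step-EV c _ K eq)
  complete-by-layer c (4 , r) eq refl ⇓N K = ↠-step (step-EV c _ K eq)
  complete-by-layer c (5 , r) eq refl (⇓C {w = w} d₁ d₂) K =
    ↠-trans (↠-step (step-EV c _ K eq))
      (↠-trans (machine-complete d₁ (sndN r) refl (CK (fstN r) K))
        (↠-trans (↠-step (step-CK w (fstN r) K)) (machine-complete d₂ (fstN r) refl K)))
  complete-by-layer c (6 , r) eq {x = x} refl (⇓P {a = a} {b = b} d₁ d₂) K =
    ↠-trans (↠-step (step-EV c x K eq))
      (↠-trans (machine-complete d₁ (fstN r) refl (P1K (sndN r) x K))
        (↠-trans (↠-step (step-P1K a (sndN r) x K))
          (↠-trans (machine-complete d₂ (sndN r) refl (P2K a K)) (↠-step (step-P2K b a K)))))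
  complete-by-layer c (7 , r) eq {x = x} refl (⇓R {v = v} d) K =
    ↠-trans (↠-step (step-EV c x K eq))
      (↠-trans (subst (λ n → EV (fstN r) (fstN x) (RK (sndN r) (fstN x) 0 n K) ↠ RT v (RK (sndN r) (fstN x) (sndN x) 0 K))
                      (+-identityʳ (sndN x)) (recursion-complete d 0 K))
        (↠-step (step-RK v (sndN r) (fstN x) (sndN x) 0 K)))
  complete-by-layer c (8 , r) eq refl (⇓M d) K = ↠-trans (↠-step (step-EV c _ K eq)) (minimisation-complete d K)
  complete-by-layer c (suc (suc (suc (suc (suc (suc (suc (suc (suc _)))))))) , r) eq refl ⇓Z K =
    ↠-step (step-EV c _ K eq)

  -- The recursion frame, started with n + rem stages, reaches stage n.
  recursion-complete : ∀ {f g a n v} → RecR (decode f) (decode g) a n v → ∀ rem K →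
                       EV f a (RK g a 0 (n + rem) K) ↠ RT v (RK g a n rem K)
  recursion-complete {f} {g} {a} (rz d) rem K = machine-complete d f refl (RK g a 0 rem K)
  recursion-complete {f} {g} {a} (rs {n} {r} d₁ d₂) rem K =
    ↠-trans (subst (λ m → EV f a (RK g a 0 m K) ↠ RT r (RK g a n (suc rem) K)) (+-suc n rem)
                   (recursion-complete d₁ (suc rem) K))
      (↠-trans (↠-step (step-RK r g a n (suc rem) K)) (machine-complete d₂ g refl (RK g a (suc n) rem K)))

  minimisation-complete : ∀ {f x i v} → MuR (decode f) x i v → ∀ K → EV f (pr x i) (MK f x i K) ↠ RT v K
  minimisation-complete {f} {x} {i} (mz d) K =
    ↠-trans (machine-complete d f refl (MK f x i K)) (↠-step (step-MK 0 f x i K))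
  minimisation-complete {f} {x} {i} (ms {w = w} d₁ d₂) K =
    ↠-trans (machine-complete d₁ f refl (MK f x i K))
      (↠-trans (↠-step (step-MK (suc w) f x i K)) (minimisation-complete d₂ K))

after-step : ∀ n {s s′ h} → step s ≡ s′ → iterate step (suc n) s ≡ h → iterate step n s′ ≡ h
after-step n {s} e h = trans (cong (iterate step n) (sym e)) (trans (sym (iterate-suc step n s)) h)

EV≢RT : ∀ {c x K v K′} → EV c x K ≡ RT v K′ → ⊥
EV≢RT e with proj₁ (pr-injective e)
... | ()

frame≢DONE : ∀ {v w t y} → RT v (pr (suc t) y) ≡ RT w DONE → ⊥
frame≢DONE {t = t} {y} e
  with trans (sym (fst-pr (suc t) y)) (cong fstN (proj₂ (pr-injective (proj₂ (pr-injective e)))))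
... | ()

from-layer : ∀ {c p x v} → unpair c ≡ p → decodeLayer p ⇓ x ↦ v → decode c ⇓ x ↦ v
from-layer {c} eq = subst (_⇓ _ ↦ _) (sym (trans (decode-unfold c) (cong decodeLayer eq)))

module Soundness (w : ℕ) where
  H : ℕ
  H = RT w DONE

  Returns : Code → ℕ → ℕ → ℕ → Set
  Returns D x K n = Σ ℕ λ v → Σ ℕ λ m → D ⇓ x ↦ v × m ≤ n × iterate step m (RT v K) ≡ H

  below : ∀ {m n b} → suc m ≤ n → n ≤ b → m ≤ b
  below m<n n≤b = ≤-trans (n≤1+n _) (≤-trans m<n n≤b)

  -- The argument b bounds the number of steps and drives the recursion.
  mutual
    eval-sound : ∀ b n → n ≤ b → ∀ c x K → iterate step n (EV c x K) ≡ H → Returns (decode c) x K n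
    eval-sound b zero _ c x K h = ⊥-elim (EV≢RT h)
    eval-sound (suc b) (suc n) (s≤s n≤b) c x K h
      with sound-by-layer b n n≤b c x K (unpair c) refl (after-step n (step-EV c x K refl) h)
    ... | v , m , d , m≤n , h′ = v , m , d , m≤n⇒m≤1+n m≤n , h′

    sound-by-layer : ∀ b n → n ≤ b → ∀ c x K p → unpair c ≡ p →
               iterate step n (evalStep (proj₁ p) (proj₂ p) x K) ≡ H → Returns (decode c) x K n
    sound-by-layer b n n≤b c x K (0 , r) eq h = 0 , n , from-layer eq ⇓Z , ≤-refl , h
    sound-by-layer b n n≤b c x K (1 , r) eq h = suc x , n , from-layer eq ⇓S , ≤-refl , h
    sound-by-layer b n n≤b c x K (2 , r) eq h = x , n , from-layer eq ⇓I , ≤-refl , h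
    sound-by-layer b n n≤b c x K (3 , r) eq h = fstN x , n , from-layer eq ⇓F , ≤-refl , h
    sound-by-layer b n n≤b c x K (4 , r) eq h = sndN x , n , from-layer eq ⇓N , ≤-refl , h
    sound-by-layer b n n≤b c x K (5 , r) eq h with eval-sound b n n≤b (sndN r) x (CK (fstN r) K) h
    ... | v₁ , zero , d₁ , m₁≤n , h₁ = ⊥-elim (frame≢DONE h₁)
    ... | v₁ , suc m₁ , d₁ , m₁<n , h₁
      with eval-sound b m₁ (below m₁<n n≤b) (fstN r) v₁ K (after-step m₁ (step-CK v₁ (fstN r) K) h₁)
    ... | v , m₂ , d₂ , m₂≤m₁ , h₂ = v , m₂ , from-layer eq (⇓C d₁ d₂) , ≤-trans m₂≤m₁ (<⇒≤ m₁<n) , h₂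
    sound-by-layer b n n≤b c x K (6 , r) eq h with eval-sound b n n≤b (fstN r) x (P1K (sndN r) x K) h
    ... | a , zero , d₁ , m₁≤n , h₁ = ⊥-elim (frame≢DONE h₁)
    ... | a , suc m₁ , d₁ , m₁<n , h₁
      with eval-sound b m₁ (below m₁<n n≤b) (sndN r) x (P2K a K) (after-step m₁ (step-P1K a (sndN r) x K) h₁)
    ... | a′ , zero , d₂ , m₂≤m₁ , h₂ = ⊥-elim (frame≢DONE h₂)
    ... | a′ , suc m₂ , d₂ , m₂<m₁ , h₂ =
      pr a a′ , m₂ , from-layer eq (⇓P d₁ d₂) , <⇒≤ (<-≤-trans m₂<m₁ (<⇒≤ m₁<n)) ,
      after-step m₂ (step-P2K a′ a K) h₂
    sound-by-layer b n n≤b c x K (7 , r) eq h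
      with eval-sound b n n≤b (fstN r) (fstN x) (RK (sndN r) (fstN x) 0 (sndN x) K) h
    ... | r₀ , m₁ , d₁ , m₁≤n , h₁
      with recursion-sound b m₁ (≤-trans m₁≤n n≤b) (fstN r) (sndN r) (fstN x) 0 (sndN x) K r₀ (rz d₁) h₁
    ... | v , m₂ , d₂ , m₂≤m₁ , h₂ = v , m₂ , from-layer eq (⇓R d₂) , ≤-trans m₂≤m₁ m₁≤n , h₂
    sound-by-layer b n n≤b c x K (8 , r) eq h with eval-sound b n n≤b r (pr x 0) (MK r x 0 K) h
    ... | v₀ , m₁ , d₁ , m₁≤n , h₁ with minimisation-sound b m₁ (≤-trans m₁≤n n≤b) r x 0 K v₀ d₁ h₁
    ... | v , m₂ , d₂ , m₂≤m₁ , h₂ = v , m₂ , from-layer eq (⇓M d₂) , ≤-trans m₂≤m₁ m₁≤n , h₂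
    sound-by-layer b n n≤b c x K (suc (suc (suc (suc (suc (suc (suc (suc (suc _)))))))) , r) eq h =
      0 , n , from-layer eq ⇓Z , ≤-refl , h

    recursion-sound : ∀ b m → m ≤ b → ∀ f g a i rem K r → RecR (decode f) (decode g) a i r →
                      iterate step m (RT r (RK g a i rem K)) ≡ H →
                      Σ ℕ λ v → Σ ℕ λ m′ → RecR (decode f) (decode g) a (i + rem) v × m′ ≤ m ×
                                            iterate step m′ (RT v K) ≡ H
    recursion-sound b zero _ f g a i rem K r d h = ⊥-elim (frame≢DONE h)
    recursion-sound (suc b) (suc m) (s≤s m≤b) f g a i zero K r d h =
      r , m , subst (λ j → RecR (decode f) (decode g) a j r) (sym (+-identityʳ i)) d , n≤1+n m ,
      after-step m (step-RK r g a i 0 K) h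
    recursion-sound (suc b) (suc m) (s≤s m≤b) f g a i (suc rem) K r d h
      with eval-sound b m m≤b g (pr a (pr i r)) (RK g a (suc i) rem K) (after-step m (step-RK r g a i (suc rem) K) h)
    ... | r′ , m₂ , d₂ , m₂≤m , h₂ with recursion-sound b m₂ (≤-trans m₂≤m m≤b) f g a (suc i) rem K r′ (rs d d₂) h₂
    ... | v , m₃ , d₃ , m₃≤m₂ , h₃ =
      v , m₃ , subst (λ j → RecR (decode f) (decode g) a j v) (sym (+-suc i rem)) d₃ ,
      ≤-trans m₃≤m₂ (≤-trans m₂≤m (n≤1+n m)) , h₃

    minimisation-sound : ∀ b m → m ≤ b → ∀ f x i K v → decode f ⇓ pr x i ↦ v →
                   iterate step m (RT v (MK f x i K)) ≡ H →
                   Σ ℕ λ u → Σ ℕ λ m′ → MuR (decode f) x i u × m′ ≤ m × iterate step m′ (RT u K) ≡ H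
    minimisation-sound b zero _ f x i K v d h = ⊥-elim (frame≢DONE h)
    minimisation-sound (suc b) (suc m) (s≤s m≤b) f x i K zero d h =
      i , m , mz d , n≤1+n m , after-step m (step-MK 0 f x i K) h
    minimisation-sound (suc b) (suc m) (s≤s m≤b) f x i K (suc v) d h
      with eval-sound b m m≤b f (pr x (suc i)) (MK f x (suc i) K) (after-step m (step-MK (suc v) f x i K) h)
    ... | v′ , m₂ , d₂ , m₂≤m , h₂ with minimisation-sound b m₂ (≤-trans m₂≤m m≤b) f x (suc i) K v′ d₂ h₂
    ... | u , m₃ , d₃ , m₃≤m₂ , h₃ = u , m₃ , ms d d₃ , ≤-trans m₃≤m₂ (≤-trans m₂≤m (n≤1+n m)) , h₃

iterate-halted : ∀ m v → iterate step m (RT v DONE) ≡ RT v DONE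
iterate-halted zero    v = refl
iterate-halted (suc m) v = trans (cong step (iterate-halted m v)) (step-DONE v)

machine-sound : ∀ n c x w → iterate step n (EV c x DONE) ≡ RT w DONE → decode c ⇓ x ↦ w
machine-sound n c x w h with Soundness.eval-sound w n n ≤-refl c x DONE h
... | v , m , d , _ , h′ =
  subst (decode c ⇓ x ↦_) (proj₁ (pr-injective (proj₂ (pr-injective (trans (sym (iterate-halted m v)) h′))))) d

run : ℕ → ℕ → ℕ → ℕ
run c x s = iterate step s (EV c x DONE)

runP : PR → PR → PR → PR
runP c x s = iterP stepP ∘P ⟨ EVp c x (kP 0) , s ⟩P

opaque
  unfolding step
  runP-correct : ∀ c x s y → ⟦ runP c x s ⟧ y ≡ run (⟦ c ⟧ y) (⟦ x ⟧ y) (⟦ s ⟧ y)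
  runP-correct c x s y rewrite unpair-pr (EV (⟦ c ⟧ y) (⟦ x ⟧ y) 0) (⟦ s ⟧ y) = refl

-- haltP tests (0 = yes) whether a state has the form RT v DONE.
haltP : PR
haltP = ifzP (predP ∘P fstP) (ifzP fstP (kP 1) (ifzP (sndP ∘P sndP) zP (kP 1))) (kP 1)

haltP-RT : ∀ v → ⟦ haltP ⟧ (RT v DONE) ≡ 0
haltP-RT v rewrite unpair-pr 1 (pr v DONE) | unpair-pr v DONE = refl

haltP-sound : ∀ s → ⟦ haltP ⟧ s ≡ 0 → s ≡ RT (fstN (sndN s)) DONE
haltP-sound s h with fstN s in e₁
haltP-sound s h | 1 with sndN (sndN s) in e₂
haltP-sound s h | 1 | 0 =
  trans (sym (pr-unpair s)) (cong₂ pr e₁ (trans (sym (pr-unpair (sndN s))) (cong (pr (fstN (sndN s))) e₂)))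
haltP-sound s () | 1 | suc _
haltP-sound s () | 0
haltP-sound s () | suc (suc _)

output : ℕ → ℕ
output s = fstN (sndN s)

HaltsIn : ℕ → ℕ → ℕ → Set
HaltsIn c x s = ⟦ haltP ⟧ (run c x s) ≡ 0

halts⇒φ : ∀ c x s → HaltsIn c x s → φ[ c ] x ↓ output (run c x s)
halts⇒φ c x s h = ⇓⇒φ (machine-sound s c x _ (haltP-sound _ h))

φ⇒halts : ∀ {c x v} → φ[ c ] x ↓ v → Σ ℕ λ s → HaltsIn c x s × output (run c x s) ≡ v
φ⇒halts {c} {x} {v} h with machine-complete (φ⇒⇓ h) c refl DONE
... | s , e = s , subst (λ st → ⟦ haltP ⟧ st ≡ 0) (sym e) (haltP-RT v) ,
  trans (cong output e) (trans (cong fstN (snd-pr 1 (pr v DONE))) (fst-pr v DONE))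

φ-encode : ∀ C {x v} → φ[ encode C ] x ↓ v ⇔ C ⇓ x ↦ v
φ-encode C = mk⇔ (λ h → subst (_⇓ _ ↦ _) (decode-encode C) (φ⇒⇓ h))
                 (λ d → ⇓⇒φ (subst (_⇓ _ ↦ _) (sym (decode-encode C)) d))

searchCode : PR → PR → PR → Code
searchCode m p q = Compc (toCode p) (Pairc (toCode q) (Muc (toCode m)))

MuR-found : ∀ {f x i u} → MuR f x i u → f ⇓ pr x u ↦ 0
MuR-found (mz d)   = d
MuR-found (ms _ r) = MuR-found r

MuR-exists : ∀ m x k i → ⟦ m ⟧ (pr x (k + i)) ≡ 0 → Σ ℕ λ u → MuR (toCode m) x i u
MuR-exists m x zero i h = i , mz (subst (toCode m ⇓ pr x i ↦_) h (compile m (pr x i)))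
MuR-exists m x (suc k) i h with ⟦ m ⟧ (pr x i) in e
... | zero  = i , mz (subst (toCode m ⇓ pr x i ↦_) e (compile m (pr x i)))
... | suc _ with MuR-exists m x k (suc i) (subst (λ z → ⟦ m ⟧ (pr x z) ≡ 0) (sym (+-suc k i)) h)
...   | u , r = u , ms (subst (toCode m ⇓ pr x i ↦_) e (compile m (pr x i))) r

searchCode-sound : ∀ m p q {x v} → searchCode m p q ⇓ x ↦ v →
                   Σ ℕ λ j → ⟦ m ⟧ (pr x j) ≡ 0 × v ≡ ⟦ p ⟧ (pr (⟦ q ⟧ x) j)
searchCode-sound m p q {x} (⇓C (⇓P {b = j} dq (⇓M r)) dp) =
  j , sym (compile-deterministic m (MuR-found r)) ,
  trans (compile-deterministic p dp) (cong (λ a → ⟦ p ⟧ (pr a j)) (compile-deterministic q dq))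

searchCode-complete : ∀ m p q {x} j → ⟦ m ⟧ (pr x j) ≡ 0 → Σ ℕ λ v → searchCode m p q ⇓ x ↦ v
searchCode-complete m p q {x} j h
  with MuR-exists m x j 0 (subst (λ z → ⟦ m ⟧ (pr x z) ≡ 0) (sym (+-identityʳ j)) h)
... | u , r = _ , ⇓C (⇓P (compile q x) (⇓M r)) (compile p _)

curryCode : Code → ℕ → Code
curryCode C e = Compc C (toCode ⟨ kP e , iP ⟩P)

encodeConstP : PR
encodeConstP = iterP ⟨ kP 5 , ⟨ kP (encode Sc) , iP ⟩P ⟩P ∘P ⟨ kP (encode Zc) , iP ⟩P

encodeConstP-correct : ∀ e → ⟦ encodeConstP ⟧ e ≡ encode (constCode e)
encodeConstP-correct e rewrite unpair-pr (encode Zc) e = iteration e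
  where
  iteration : ∀ e → iterate ⟦ ⟨ kP 5 , ⟨ kP (encode Sc) , iP ⟩P ⟩P ⟧ e (encode Zc) ≡ encode (constCode e)
  iteration zero    = refl
  iteration (suc e) = cong (λ z → pr 5 (pr (encode Sc) z)) (iteration e)

curryP : Code → PR
curryP C = ⟨ kP 5 , ⟨ kP (encode C) , ⟨ kP 6 , ⟨ encodeConstP , kP (encode Ic) ⟩P ⟩P ⟩P ⟩P

curryP-correct : ∀ C e → ⟦ curryP C ⟧ e ≡ encode (curryCode C e)
curryP-correct C e rewrite encodeConstP-correct e = refl

φ-curry : ∀ C e x v → φ[ ⟦ curryP C ⟧ e ] x ↓ v ⇔ C ⇓ pr e x ↦ v
φ-curry C e x v = mk⇔ to from
  where
  as-code : ∀ {x v} → φ[ ⟦ curryP C ⟧ e ] x ↓ v ⇔ curryCode C e ⇓ x ↦ v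
  as-code rewrite curryP-correct C e = φ-encode (curryCode C e)
  to : φ[ ⟦ curryP C ⟧ e ] x ↓ v → C ⇓ pr e x ↦ v
  to h with Equivalence.to as-code h
  ... | ⇓C {w = w} d₁ d₂ = subst (λ z → C ⇓ z ↦ v) (compile-deterministic ⟨ kP e , iP ⟩P d₁) d₂
  from : C ⇓ pr e x ↦ v → φ[ ⟦ curryP C ⟧ e ] x ↓ v
  from d = Equivalence.from as-code (⇓C (compile ⟨ kP e , iP ⟩P x) d)

reduction : ∀ (p : PR) {X E Y F} → (∀ x → X x → Y (⟦ p ⟧ x)) →
            (∀ x x′ → X x → X x′ → E x x′ ⇔ F (⟦ p ⟧ x) (⟦ p ⟧ x′)) → Reduces X E Y F
reduction p {X} {E} {Y} {F} maps-into preserves = encode (toCode p) , total , reduces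
  where
  value : ∀ {x y} → φ[ encode (toCode p) ] x ↓ y → y ≡ ⟦ p ⟧ x
  value h = compile-deterministic p (Equivalence.to (φ-encode (toCode p)) h)

  total : ∀ x → X x → ∃ λ y → φ[ encode (toCode p) ] x ↓ y × Y y
  total x x∈X = ⟦ p ⟧ x , Equivalence.from (φ-encode (toCode p)) (compile p x) , maps-into x x∈X

  reduces : ∀ x x′ y y′ → X x → X x′ → φ[ encode (toCode p) ] x ↓ y → φ[ encode (toCode p) ] x′ ↓ y′ →
            E x x′ ⇔ F y y′
  reduces x x′ y y′ x∈X x′∈X h h′ rewrite value h | value h′ = preserves x x′ x∈X x′∈X

haltsP : PR → PR → PR → PR
haltsP c x s = haltP ∘P runP c x s

haltsP-correct : ∀ c x s y → ⟦ haltsP c x s ⟧ y ≡ ⟦ haltP ⟧ (run (⟦ c ⟧ y) (⟦ x ⟧ y) (⟦ s ⟧ y))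
haltsP-correct c x s y = cong ⟦ haltP ⟧ (runP-correct c x s y)

-- Every W_e is the range of a partial computable function, uniformly in e:
-- φ_{g(e)} maps ⟨ n , s ⟩ to n when φ_e(n) converges within s machine steps.
module Enumerator where
  haltedTest : PR      -- on ⟨ ⟨ e , ⟨ n , s ⟩ ⟩ , j ⟩
  haltedTest = haltsP (fstP ∘P fstP) (fstP ∘P sndP ∘P fstP) (sndP ∘P sndP ∘P fstP)

  haltedTest-correct : ∀ e y j → ⟦ haltedTest ⟧ (pr (pr e y) j) ≡ ⟦ haltP ⟧ (run e (fstN y) (sndN y))
  haltedTest-correct e y j
    rewrite haltsP-correct (fstP ∘P fstP) (fstP ∘P sndP ∘P fstP) (sndP ∘P sndP ∘P fstP) (pr (pr e y) j)
          | unpair-pr (pr e y) j | unpair-pr e y = refl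

  enumeratorCode : Code  -- on ⟨ e , y ⟩
  enumeratorCode = searchCode haltedTest (fstP ∘P fstP) sndP

  enumeratorCode-sound : ∀ {e y v} → enumeratorCode ⇓ pr e y ↦ v → HaltsIn e (fstN y) (sndN y) × v ≡ fstN y
  enumeratorCode-sound {e} {y} d with searchCode-sound haltedTest (fstP ∘P fstP) sndP d
  ... | j , halted , v≡ rewrite snd-pr e y | fst-pr y j =
    trans (sym (haltedTest-correct e y j)) halted , v≡

  enumeratorCode-complete : ∀ {e n s} → HaltsIn e n s → enumeratorCode ⇓ pr e (pr n s) ↦ n
  enumeratorCode-complete {e} {n} {s} halts
    with searchCode-complete haltedTest (fstP ∘P fstP) sndP 0
           (trans (haltedTest-correct e (pr n s) 0)
                  (subst₂ (λ a b → ⟦ haltP ⟧ (run e a b) ≡ 0) (sym (fst-pr n s)) (sym (snd-pr n s)) halts))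
  ... | v , d = subst (enumeratorCode ⇓ pr e (pr n s) ↦_) (trans (proj₂ (enumeratorCode-sound d)) (fst-pr n s)) d

enumeratorP : PR
enumeratorP = curryP Enumerator.enumeratorCode

W-enumeratorP : ∀ e → W e ≐ Range (⟦ enumeratorP ⟧ e)
W-enumeratorP e m = mk⇔ to from
  where
  open Enumerator
  to : W e m → Range (⟦ enumeratorP ⟧ e) m
  to (_ , h) with φ⇒halts h
  ... | s , halts , _ = pr m s , Equivalence.from (φ-curry enumeratorCode e _ m) (enumeratorCode-complete halts)
  from : Range (⟦ enumeratorP ⟧ e) m → W e m
  from (y , h) with enumeratorCode-sound (Equivalence.to (φ-curry enumeratorCode e y m) h)
  ... | halts , refl = _ , halts⇒φ e (fstN y) (sndN y) halts

ifz-both : ∀ a b → ifz a b 1 ≡ 0 → a ≡ 0 × b ≡ 0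
ifz-both zero    b h = refl , h
ifz-both (suc _) b ()

-- For the c.e. relation R m n :⇔ ⟨ m , n ⟩ ∈ W_i, the R-image of the range
-- of φ_e is c.e. uniformly in e: n enters W_{f(e)} once some φ_e(n′) = m and
-- φ_i(⟨ m , n ⟩) are seen to converge.
module ImageEnumeration (i : ℕ) where
  -- Both runs, on ⟨ ⟨ e , n ⟩ , ⟨ n′ , ⟨ s , t ⟩ ⟩ ⟩.
  firstRun secondRun witnessTest : PR
  firstRun    = runP (fstP ∘P fstP) (fstP ∘P sndP) (fstP ∘P sndP ∘P sndP)
  secondRun   = runP (kP i) ⟨ fstP ∘P sndP ∘P firstRun , sndP ∘P fstP ⟩P (sndP ∘P sndP ∘P sndP)
  witnessTest = ifzP (haltP ∘P firstRun) (haltP ∘P secondRun) (kP 1)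

  witnessed : ℕ → ℕ → ℕ → ℕ → ℕ → ℕ
  witnessed e n n′ s t = ifz (⟦ haltP ⟧ (run e n′ s)) (⟦ haltP ⟧ (run i (pr (output (run e n′ s)) n) t)) 1

  witnessTest-correct : ∀ e n j → ⟦ witnessTest ⟧ (pr (pr e n) j) ≡ witnessed e n (fstN j) (fstN (sndN j)) (sndN (sndN j))
  witnessTest-correct e n j
    rewrite runP-correct (kP i) ⟨ fstP ∘P sndP ∘P firstRun , sndP ∘P fstP ⟩P (sndP ∘P sndP ∘P sndP) (pr (pr e n) j)
          | runP-correct (fstP ∘P fstP) (fstP ∘P sndP) (fstP ∘P sndP ∘P sndP) (pr (pr e n) j)
          | unpair-pr (pr e n) j | unpair-pr e n = refl

  witnessTest-at : ∀ e n n′ s t → ⟦ witnessTest ⟧ (pr (pr e n) (pr n′ (pr s t))) ≡ witnessed e n n′ s t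
  witnessTest-at e n n′ s t
    rewrite witnessTest-correct e n (pr n′ (pr s t)) | unpair-pr n′ (pr s t) | unpair-pr s t = refl

  witness-sound : ∀ e n n′ s t → witnessed e n n′ s t ≡ 0 → Image (λ m n → W i (pair m n)) e n
  witness-sound e n n′ s t w≡0 =
    m , (n′ , halts⇒φ e n′ s (proj₁ halts)) ,
    (_ , subst (λ z → φ[ i ] z ↓ output (run i (pr m n) t)) (pr≡pair m n) (halts⇒φ i (pr m n) t (proj₂ halts)))
    where
    m : ℕ
    m = output (run e n′ s)
    halts : HaltsIn e n′ s × HaltsIn i (pr m n) t
    halts = ifz-both (⟦ haltP ⟧ (run e n′ s)) (⟦ haltP ⟧ (run i (pr m n) t)) w≡0

  witness-complete : ∀ e n m → Range e m → W i (pair m n) → ∃ λ j → ⟦ witnessTest ⟧ (pr (pr e n) j) ≡ 0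
  witness-complete e n m (n′ , h₁) (u , h₂)
    with φ⇒halts h₁ | φ⇒halts (subst (λ z → φ[ i ] z ↓ u) (sym (pr≡pair m n)) h₂)
  ... | s , halts₁ , refl | t , halts₂ , _ =
    pr n′ (pr s t) ,
    trans (witnessTest-at e n n′ s t)
          (subst (λ a → ifz a (⟦ haltP ⟧ (run i (pr (output (run e n′ s)) n) t)) 1 ≡ 0) (sym halts₁) halts₂)

  imageCode : Code       -- on ⟨ e , n ⟩
  imageCode = searchCode witnessTest zP zP

imageP : ℕ → PR
imageP i = curryP (ImageEnumeration.imageCode i)

W-imageP : ∀ i e → W (⟦ imageP i ⟧ e) ≐ Image (λ m n → W i (pair m n)) e
W-imageP i e n = mk⇔ to from
  where
  open ImageEnumeration i
  to : W (⟦ imageP i ⟧ e) n → Image (λ m n → W i (pair m n)) e n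
  to (v , h) with searchCode-sound witnessTest zP zP (Equivalence.to (φ-curry imageCode e n v) h)
  ... | j , test≡0 , _ =
    witness-sound e n (fstN j) (fstN (sndN j)) (sndN (sndN j)) (trans (sym (witnessTest-correct e n j)) test≡0)
  from : Image (λ m n → W i (pair m n)) e n → W (⟦ imageP i ⟧ e) n
  from (m , range , related) with witness-complete e n m range related
  ... | j , test≡0 with searchCode-complete witnessTest zP zP j test≡0
  ... | v , d = v , Equivalence.from (φ-curry imageCode e n v) d

module CeerReductions {E : Rel} (isEquivalence : IsEquivalence E) (i : ℕ)
                      (E⇔Wi : ∀ x y → E x y ⇔ W i (pair x y)) where

  saturateP : PR
  saturateP = imageP i

  W-saturate : ∀ x → W (⟦ saturateP ⟧ x) ≐ Image E x
  W-saturate x n = ⇔-trans (W-imageP i x n) (Image-cong (λ m n → ⇔-sym (E⇔Wi m n)) x n)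

  Jump⇔=ce : ∀ x x′ → Jump E x x′ ⇔ (⟦ saturateP ⟧ x =ce ⟦ saturateP ⟧ x′)
  Jump⇔=ce x x′ =
    ⇔-trans (Jump⇔Image isEquivalence x x′) (≐-cong (≐-sym (W-saturate x)) (≐-sym (W-saturate x′)))

  saturation-invariant : ∀ x → Invariant E (⟦ saturateP ⟧ x)
  saturation-invariant x a b aEb =
    Equivalence.from (W-saturate x b) ∘ Image-invariant isEquivalence x aEb ∘ Equivalence.to (W-saturate x a)

  saturated : ∀ x → Invariant E x → Image E (⟦ enumeratorP ⟧ x) ≐ W x
  saturated x invariant = Image-of-invariant isEquivalence x (⟦ enumeratorP ⟧ x) invariant (W-enumeratorP x)

  =ce⇔Jump : ∀ x x′ → Invariant E x → Invariant E x′ →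
             (x =ce x′) ⇔ Jump E (⟦ enumeratorP ⟧ x) (⟦ enumeratorP ⟧ x′)
  =ce⇔Jump x x′ invariant invariant′ =
    ⇔-trans (≐-cong (≐-sym (saturated x invariant)) (≐-sym (saturated x′ invariant′)))
            (⇔-sym (Jump⇔Image isEquivalence (⟦ enumeratorP ⟧ x) (⟦ enumeratorP ⟧ x′)))

proposition4p1 : (E : Rel) → IsCeer E →
    Reduces Everything (Jump E) Everything _=ce_ ×
    Reduces Everything (Jump E) (Invariant E) _=ce_ ×
    Reduces (Invariant E) _=ce_ Everything (Jump E)
proposition4p1 E (isEquivalence , i , E⇔Wi) =
    reduction saturateP (λ _ _ → tt) (λ x x′ _ _ → Jump⇔=ce x x′)
  , reduction saturateP (λ x _ → saturation-invariant x) (λ x x′ _ _ → Jump⇔=ce x x′)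
  , reduction enumeratorP (λ _ _ → tt) =ce⇔Jump
  where open CeerReductions isEquivalence i E⇔Wi
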